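{- Let $k<\ell$ and $s$ be positive integers and let $\mathbf{c}\in\mathbb{N}_0^\ell$. If there exists an $s\times\ell$ matrix with entries in $\{0,1\}$, all of whose row sums equal $k$ and whose column-sum vector is $\mathbf{c}$, then $\iota(\mathbf{c})\le\iota_{\max}(k,\ell)$.
   Context: $\mathbb{N}_0=\{0,1,2,\dots\}$. For a tuple $\mathbf{c}$, $\iota(\mathbf{c})$ is the number of entries of $\mathbf{c}$ equal to $1$. For natural numbers $k<\ell$, with $\psi=\lceil\ell/k\rceil$, $\iota_{\max}(k,\ell)=\max\left\{(\psi-1)k,\ \frac{\psi}{\psi-1}(\ell-k)\right\}$. -}

module Defs where

open import Data.Nat as ℕ using (ℕ; zero; suc; _+_; _*_; _∸_; _<_; _≤_; NonZero)
open import Data.Nat.DivMod using (_/_)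
open import Data.Fin using (Fin)
open import Data.Vec.Functional using (Vector)
open import Data.Integer using (+_)
open import Data.Rational as ℚ using (ℚ)
open import Data.Bool using (Bool; true; false)
open import Data.List using (List; length; filter; map; allFin)
open import Data.Nat.ListAction using (sum)
open import Relation.Nullary.Decidable using (Dec)
open import Relation.Binary.PropositionalEquality using (_≡_)

⌈_/_⌉ : (a b : ℕ) .{{_ : NonZero b}} → ℕ
⌈ a / b ⌉ = (a + (b ∸ 1)) / b

Σ-fin : (n : ℕ) → (Fin n → ℕ) → ℕ
Σ-fin n f = sum (map f (allFin n))

ι : {ℓ : ℕ} → Vector ℕ ℓ → ℕ
ι {ℓ} c = length (filter (λ i → c i ℕ.≟ 1) (allFin ℓ))

-- 0/1 matrices: s rows, ℓ columns, entries in Bool (true = 1)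
bit : Bool → ℕ
bit true  = 1
bit false = 0

rowSum : {s ℓ : ℕ} → (Fin s → Fin ℓ → Bool) → Fin s → ℕ
rowSum {s} {ℓ} M i = Σ-fin ℓ (λ j → bit (M i j))

colSum : {s ℓ : ℕ} → (Fin s → Fin ℓ → Bool) → Fin ℓ → ℕ
colSum {s} {ℓ} M j = Σ-fin s (λ i → bit (M i j))

-- ι_max(k, ℓ) = max { (ψ-1) k , ψ/(ψ-1) (ℓ-k) } ∈ ℚ, where ψ = ⌈ℓ/k⌉.
-- The second term needs ψ-1 ≠ 0, which holds whenever k < ℓ (the only case used);
-- in the degenerate case ψ-1 = 0 we just return the first term.
ιmax-aux : (ψ k ℓ : ℕ) → ℚ
ιmax-aux zero          k ℓ = (+ 0) ℚ./ 1
ιmax-aux (suc zero)    k ℓ = (+ 0) ℚ./ 1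
ιmax-aux (suc (suc m)) k ℓ =
  ((+ (suc m * k)) ℚ./ 1) ℚ.⊔ ((+ (suc (suc m) * (ℓ ∸ k))) ℚ./ suc m)

ιmax : (k ℓ : ℕ) .{{_ : NonZero k}} → ℚ
ιmax k ℓ = ιmax-aux ⌈ ℓ / k ⌉ k ℓ

-- Let T be the set of columns of column sum 1 and t = |T|. The single 1 of a T-column lies in exactly
-- one row, so the numbers of T-columns hit by the rows add up to t. A row hits at most k of them and
-- misses at most ℓ − k, since the missed ones are zeros of the row. Summing over the s rows gives
-- t ≤ s k and s t ≤ t + s (ℓ − k). With ψ = ⌈ℓ/k⌉ ≥ 2: if s ≤ ψ − 1 the first bound gives
-- t ≤ (ψ − 1) k; otherwise the second gives t ≤ s/(s − 1) (ℓ − k) ≤ ψ/(ψ − 1) (ℓ − k).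
module Submission where

open import Defs

module Counting where

  open import Data.Bool.Base using (Bool; true; false; not)
  open import Data.Fin.Base using (Fin; zero; suc)
  open import Data.List.Base using (List; []; _∷_; length; filter; map; tabulate; allFin)
  open import Data.List.Properties using (map-tabulate)
  open import Data.Nat.Base
  open import Data.Nat.DivMod using (m*n/n≡m; /-monoˡ-≤)
  open import Data.Nat.ListAction using (sum)
  open import Data.Nat.Properties
  open import Algebra.Properties.CommutativeSemigroup *-commutativeSemigroup using (x∙yz≈y∙xz)
  open import Algebra.Properties.Semiring.Sum +-*-semiring
    using (sum-syntax; ∑-distrib-+; ∑-comm; *-distribˡ-sum; sum-cong-≗)
  open import Data.Sum.Base using (_⊎_; inj₁; inj₂)
  open import Function.Base using (id; _∘_)
  open import Relation.Nullary.Decidable.Core using (does; yes; no)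
  open import Relation.Unary using (Pred; Decidable)
  open import Relation.Binary.PropositionalEquality
    using (_≡_; refl; sym; trans; cong; cong₂; subst; module ≡-Reasoning)

  sum-tabulate≡∑ : ∀ {n} (f : Fin n → ℕ) → sum (tabulate f) ≡ ∑[ i < n ] f i
  sum-tabulate≡∑ {zero}  f = refl
  sum-tabulate≡∑ {suc n} f = cong (f zero +_) (sum-tabulate≡∑ (f ∘ suc))

  Σ-fin≡∑ : ∀ n (f : Fin n → ℕ) → Σ-fin n f ≡ ∑[ i < n ] f i
  Σ-fin≡∑ n f = trans (cong sum (map-tabulate id f)) (sum-tabulate≡∑ f)

  ∑-const : ∀ n x → ∑[ _ < n ] x ≡ n * x
  ∑-const zero    x = refl
  ∑-const (suc n) x = cong (x +_) (∑-const n x)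

  ∑-mono-≤ : ∀ {n} {f g : Fin n → ℕ} → (∀ i → f i ≤ g i) → ∑[ i < n ] f i ≤ ∑[ i < n ] g i
  ∑-mono-≤ {zero}  f≤g = z≤n
  ∑-mono-≤ {suc n} f≤g = +-mono-≤ (f≤g zero) (∑-mono-≤ (f≤g ∘ suc))

  length-filter≡sum-bit : ∀ {a} {A : Set a} {p} {P : Pred A p} (P? : Decidable P) (xs : List A) →
    length (filter P? xs) ≡ sum (map (bit ∘ does ∘ P?) xs)
  length-filter≡sum-bit P? []       = refl
  length-filter≡sum-bit P? (x ∷ xs) with does (P? x)
  ... | true  = cong suc (length-filter≡sum-bit P? xs)
  ... | false = length-filter≡sum-bit P? xs

  isOne : ℕ → Bool
  isOne n = does (n ≟ 1)

  isOne⇒≡1 : ∀ n → isOne n ≡ true → n ≡ 1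
  isOne⇒≡1 0             ()
  isOne⇒≡1 1             _ = refl
  isOne⇒≡1 (suc (suc _)) ()

  ι≡∑-isOne : ∀ {ℓ} (c : Fin ℓ → ℕ) → ι c ≡ ∑[ j < ℓ ] bit (isOne (c j))
  ι≡∑-isOne {ℓ} c =
    trans (length-filter≡sum-bit (λ j → c j ≟ 1) (allFin ℓ)) (Σ-fin≡∑ ℓ (bit ∘ isOne ∘ c))

  ∑-bit+∑-bit-not : ∀ {n} (b : Fin n → Bool) → ∑[ j < n ] bit (b j) + ∑[ j < n ] bit (not (b j)) ≡ n
  ∑-bit+∑-bit-not {n} b = begin
    ∑[ j < n ] bit (b j) + ∑[ j < n ] bit (not (b j)) ≡⟨ ∑-distrib-+ (bit ∘ b) (bit ∘ not ∘ b) ⟨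
    ∑[ j < n ] (bit (b j) + bit (not (b j)))           ≡⟨ sum-cong-≗ (bit+bit-not ∘ b) ⟩
    ∑[ _ < n ] 1                                       ≡⟨ ∑-const n 1 ⟩
    n * 1                                              ≡⟨ *-identityʳ n ⟩
    n                                                  ∎
    where
    open ≡-Reasoning
    bit+bit-not : ∀ x → bit x + bit (not x) ≡ 1
    bit+bit-not true  = refl
    bit+bit-not false = refl

  ∑-bit-not : ∀ {n} (b : Fin n → Bool) → ∑[ j < n ] bit (not (b j)) ≡ n ∸ ∑[ j < n ] bit (b j)
  ∑-bit-not {n} b =
    trans (sym (m+n∸m≡n (∑[ j < n ] bit (b j)) _)) (cong (_∸ ∑[ j < n ] bit (b j)) (∑-bit+∑-bit-not b))

  module SingletonColumns {s ℓ} (M : Fin s → Fin ℓ → Bool) (T : Fin ℓ → Bool)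
                          (T⇒colSum≡1 : ∀ j → T j ≡ true → colSum M j ≡ 1) where

    #T : ℕ
    #T = ∑[ j < ℓ ] bit (T j)

    hits : Fin s → ℕ
    hits i = ∑[ j < ℓ ] (bit (T j) * bit (M i j))

    ∑-hits≡#T : ∑[ i < s ] hits i ≡ #T
    ∑-hits≡#T = begin
      ∑[ i < s ] ∑[ j < ℓ ] (bit (T j) * bit (M i j))  ≡⟨ ∑-comm (λ i j → bit (T j) * bit (M i j)) ⟩
      ∑[ j < ℓ ] ∑[ i < s ] (bit (T j) * bit (M i j))  ≡⟨ sum-cong-≗ (λ j → *-distribˡ-sum (bit (T j)) (λ i → bit (M i j))) ⟨
      ∑[ j < ℓ ] (bit (T j) * ∑[ i < s ] bit (M i j))  ≡⟨ sum-cong-≗ (λ j → cong (bit (T j) *_) (Σ-fin≡∑ s (λ i → bit (M i j)))) ⟨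
      ∑[ j < ℓ ] (bit (T j) * colSum M j)              ≡⟨ sum-cong-≗ (λ j → bit-*-singleton (T j) (T⇒colSum≡1 j)) ⟩
      #T                                               ∎
      where
      open ≡-Reasoning
      bit-*-singleton : ∀ {n} b → (b ≡ true → n ≡ 1) → bit b * n ≡ bit b
      bit-*-singleton true  n≡1 = trans (+-identityʳ _) (n≡1 refl)
      bit-*-singleton false _   = refl

    rowSum≡∑ : ∀ i → rowSum M i ≡ ∑[ j < ℓ ] bit (M i j)
    rowSum≡∑ i = Σ-fin≡∑ ℓ (λ j → bit (M i j))

    hits≤rowSum : ∀ i → hits i ≤ rowSum M i
    hits≤rowSum i = subst (hits i ≤_) (sym (rowSum≡∑ i)) (∑-mono-≤ (λ j → bit-*-≤ (T j) (M i j)))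
      where
      bit-*-≤ : ∀ a b → bit a * bit b ≤ bit b
      bit-*-≤ true  true  = ≤-refl
      bit-*-≤ true  false = z≤n
      bit-*-≤ false _     = z≤n

    -- The T-columns missed by row i lie among its ℓ ∸ rowSum M i zero entries.
    #T≤hits+zeros : ∀ i → #T ≤ hits i + (ℓ ∸ rowSum M i)
    #T≤hits+zeros i = begin
      #T                                                        ≤⟨ ∑-mono-≤ (λ j → bit≤bit*bit+bit-not (T j) (M i j)) ⟩
      ∑[ j < ℓ ] (bit (T j) * bit (M i j) + bit (not (M i j))) ≡⟨ ∑-distrib-+ (λ j → bit (T j) * bit (M i j)) _ ⟩
      hits i + ∑[ j < ℓ ] bit (not (M i j))                    ≡⟨ cong (hits i +_) (∑-bit-not (M i)) ⟩
      hits i + (ℓ ∸ ∑[ j < ℓ ] bit (M i j))                    ≡⟨ cong (λ r → hits i + (ℓ ∸ r)) (rowSum≡∑ i) ⟨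
      hits i + (ℓ ∸ rowSum M i)                                ∎
      where
      open ≤-Reasoning
      bit≤bit*bit+bit-not : ∀ a b → bit a ≤ bit a * bit b + bit (not b)
      bit≤bit*bit+bit-not true  true  = ≤-refl
      bit≤bit*bit+bit-not true  false = ≤-refl
      bit≤bit*bit+bit-not false _     = z≤n

    module _ {k} (rows : ∀ i → rowSum M i ≡ k) where

      #T≤s*k : #T ≤ s * k
      #T≤s*k = begin
        #T                ≡⟨ ∑-hits≡#T ⟨
        ∑[ i < s ] hits i ≤⟨ ∑-mono-≤ (λ i → subst (hits i ≤_) (rows i) (hits≤rowSum i)) ⟩
        ∑[ _ < s ] k      ≡⟨ ∑-const s k ⟩
        s * k             ∎
        where open ≤-Reasoning

      s*#T≤#T+s*[ℓ∸k] : s * #T ≤ #T + s * (ℓ ∸ k)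
      s*#T≤#T+s*[ℓ∸k] = begin
        s * #T                                 ≡⟨ ∑-const s #T ⟨
        ∑[ _ < s ] #T                          ≤⟨ ∑-mono-≤ (λ i → subst (λ r → #T ≤ hits i + (ℓ ∸ r)) (rows i) (#T≤hits+zeros i)) ⟩
        ∑[ i < s ] (hits i + (ℓ ∸ k))          ≡⟨ ∑-distrib-+ hits _ ⟩
        ∑[ i < s ] hits i + ∑[ _ < s ] (ℓ ∸ k) ≡⟨ cong₂ _+_ ∑-hits≡#T (∑-const s (ℓ ∸ k)) ⟩
        #T + s * (ℓ ∸ k)                       ∎
        where open ≤-Reasoning

  -- As ratios: t / d ≤ (1 + n) / n implies t / d ≤ (1 + m) / m, since (1 + n) / n decreases in n.
  *≤suc*-antitone : ∀ {m n t d} → m ≤ n → n * t ≤ suc n * d → m * t ≤ suc m * d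
  *≤suc*-antitone {zero}                  _   _   = z≤n
  *≤suc*-antitone {suc m} {suc n} {t} {d} m≤n nt≤ = *-cancelˡ-≤ (suc n) (begin
    suc n * (suc m * t)         ≡⟨ x∙yz≈y∙xz (suc n) (suc m) t ⟩
    suc m * (suc n * t)         ≤⟨ *-monoʳ-≤ (suc m) nt≤ ⟩
    suc m * (suc (suc n) * d)   ≡⟨ *-assoc (suc m) (suc (suc n)) d ⟨
    suc m * suc (suc n) * d     ≤⟨ *-monoˡ-≤ d cross ⟩
    suc n * suc (suc m) * d     ≡⟨ *-assoc (suc n) (suc (suc m)) d ⟩
    suc n * (suc (suc m) * d)   ∎)
    where
    open ≤-Reasoning
    cross : suc m * suc (suc n) ≤ suc n * suc (suc m)
    cross = begin
      suc m * suc (suc n)       ≡⟨ *-suc (suc m) (suc n) ⟩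
      suc m + suc m * suc n     ≤⟨ +-mono-≤ m≤n (≤-reflexive (*-comm (suc m) (suc n))) ⟩
      suc n + suc n * suc m     ≡⟨ *-suc (suc n) (suc m) ⟨
      suc n * suc (suc m)       ∎

  two-regimes : ∀ {s t k d} → t ≤ s * k → s * t ≤ t + s * d →
    ∀ m → t ≤ suc m * k ⊎ suc m * t ≤ suc (suc m) * d
  two-regimes {zero}      t≤0  _   m = inj₁ (≤-trans t≤0 z≤n)
  two-regimes {suc n} {t} t≤sk st≤ m with suc n ≤? suc m
  ... | yes s≤1+m = inj₁ (≤-trans t≤sk (*-monoˡ-≤ _ s≤1+m))
  ... | no  s≰1+m = inj₂ (*≤suc*-antitone (≤-pred (≰⇒> s≰1+m)) (+-cancelˡ-≤ t _ _ st≤))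

  ι-two-regimes : ∀ {s ℓ k} (M : Fin s → Fin ℓ → Bool) (c : Fin ℓ → ℕ) →
    (∀ i → rowSum M i ≡ k) → (∀ j → colSum M j ≡ c j) →
    ∀ m → ι c ≤ suc m * k ⊎ suc m * ι c ≤ suc (suc m) * (ℓ ∸ k)
  ι-two-regimes {s} {ℓ} {k} M c rows cols rewrite ι≡∑-isOne c =
    two-regimes {s} {d = ℓ ∸ k} (#T≤s*k rows) (s*#T≤#T+s*[ℓ∸k] rows)
    where open SingletonColumns M (isOne ∘ c) (λ j isOne-cj → trans (cols j) (isOne⇒≡1 (c j) isOne-cj))

  k<ℓ⇒2*k≤ℓ+[k∸1] : ∀ {k ℓ} → k < ℓ → 2 * k ≤ ℓ + (k ∸ 1)
  k<ℓ⇒2*k≤ℓ+[k∸1] {zero}   _   = z≤n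
  k<ℓ⇒2*k≤ℓ+[k∸1] {suc k} k<ℓ = begin
    2 * suc k           ≡⟨ cong suc (trans (cong (k +_) (+-identityʳ (suc k))) (+-suc k k)) ⟩
    suc (suc k) + k     ≤⟨ +-monoˡ-≤ k k<ℓ ⟩
    _ + k               ∎
    where open ≤-Reasoning

  2≤⌈ℓ/k⌉ : ∀ {k ℓ} .{{_ : NonZero k}} → k < ℓ → 2 ≤ ⌈ ℓ / k ⌉
  2≤⌈ℓ/k⌉ {k} k<ℓ = subst (_≤ ⌈ _ / k ⌉) (m*n/n≡m 2 k) (/-monoˡ-≤ k (k<ℓ⇒2*k≤ℓ+[k∸1] k<ℓ))

open import Data.Nat using (ℕ; _<_; NonZero)
open import Data.Fin using (Fin)
open import Data.Vec.Functional using (Vector)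
open import Data.Bool using (Bool)
open import Data.Product using (∃; _×_)
open import Data.Integer using (+_)
open import Data.Rational using (_≤_; _/_)
open import Relation.Binary.PropositionalEquality using (_≡_)

open import Data.Nat as ℕ using (suc; _*_; _∸_)
open import Data.Nat.Properties using (*-monoˡ-≤; *-comm; *-identityʳ)
open import Data.Product using (_,_)
open import Data.Sum using (inj₁; inj₂; _⊎_)
open import Data.Rational.Properties using (toℚᵘ-cancel-≤; toℚᵘ-fromℚᵘ; p≤q⇒p≤q⊔r; p≤q⇒p≤r⊔q)
open import Relation.Binary.PropositionalEquality using (sym; subst₂)
import Data.Integer as ℤ
import Data.Integer.Properties as ℤ
import Data.Rational.Unnormalised as ℚᵘ
import Data.Rational.Unnormalised.Properties as ℚᵘ
open Counting using (ι-two-regimes; 2≤⌈ℓ/k⌉)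

*≤*⇒/≤/ : ∀ a m b n → a * suc n ℕ.≤ b * suc m → (+ a) / suc m ≤ (+ b) / suc n
*≤*⇒/≤/ a m b n an≤bm = toℚᵘ-cancel-≤
  (ℚᵘ.≤-respˡ-≃ (ℚᵘ.≃-sym (toℚᵘ-fromℚᵘ (ℚᵘ.mkℚᵘ (+ a) m)))
  (ℚᵘ.≤-respʳ-≃ (ℚᵘ.≃-sym (toℚᵘ-fromℚᵘ (ℚᵘ.mkℚᵘ (+ b) n)))
  (ℚᵘ.*≤* (subst₂ ℤ._≤_ (ℤ.pos-* a (suc n)) (ℤ.pos-* b (suc m)) (ℤ.+≤+ an≤bm)))))

ιmax-aux-bound : ∀ {t k ℓ} ψ → 2 ℕ.≤ ψ →
  (∀ m → t ℕ.≤ suc m * k ⊎ suc m * t ℕ.≤ suc (suc m) * (ℓ ∸ k)) → (+ t) / 1 ≤ ιmax-aux ψ k ℓ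
ιmax-aux-bound {t} {k} {ℓ} (suc (suc m)) (ℕ.s≤s (ℕ.s≤s ℕ.z≤n)) regimes with regimes m
... | inj₁ t≤ = p≤q⇒p≤q⊔r _ (*≤*⇒/≤/ t 0 (suc m * k) 0 (*-monoˡ-≤ 1 t≤))
... | inj₂ ≤d = p≤q⇒p≤r⊔q ((+ (suc m * k)) / 1)
  (*≤*⇒/≤/ t 0 (suc (suc m) * (ℓ ∸ k)) m (subst₂ ℕ._≤_ (*-comm (suc m) t) (sym (*-identityʳ _)) ≤d))

lemma2p7 : (k ℓ s : ℕ) .{{_ : NonZero k}} .{{_ : NonZero s}} → k < ℓ →
    (c : Vector ℕ ℓ) →
    ∃ (λ (M : Fin s → Fin ℓ → Bool) →
      ((i : Fin s) → rowSum M i ≡ k) × ((j : Fin ℓ) → colSum M j ≡ c j)) →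
    (+ ι c) / 1 ≤ ιmax k ℓ
lemma2p7 k ℓ s k<ℓ c (M , rows , cols) =
  ιmax-aux-bound ⌈ ℓ / k ⌉ (2≤⌈ℓ/k⌉ k<ℓ) (ι-two-regimes M c rows cols)
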